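{- Let $P$ be a finite poset on $n$ elements and let $p_i\in P$. Define $\varphi_{p_i}:\mathcal{L}(P\setminus\{p_i\})\to\mathcal{L}(P)$ as follows: given a linear extension $\lambda'$ of $P\setminus\{p_i\}$ (with values in $[n-1]$), set $\lambda(p_i)=n$ and $\lambda(q)=\lambda'(q)$ for $q\ne p_i$; then, while the element $p_a$ with $\lambda(p_a)=n$ is not maximal in $P$, choose the element $p_b$ covering $p_a$ with the smallest $\lambda$-value and swap the values $\lambda(p_a)$ and $\lambda(p_b)$. The result is a linear extension of $P$. Then $\varphi_{p_i}$ is injective, and its image consists exactly of those $\lambda\in\mathcal{L}(P)$ whose promotion chain passes through $p_i$.
   Context: A linear extension of a poset $Q$ with $m$ elements is an order-preserving bijection $Q\to[m]=\{1<\dots<m\}$; $\mathcal{L}(Q)$ denotes the set of them. The promotion chain of $\lambda\in\mathcal{L}(P)$ is the saturated chain $t_1>t_2>\dots>t_\ell$ from a maximal to a minimal element of $P$ where $t_1=\lambda^{ -1}(n)$ and, for each $i$, $t_{i+1}$ is the element covered by $t_i$ with the largest $\lambda$-value (the chain ends at a minimal element). -}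

module Defs where

open import Data.Nat using (ℕ; zero; suc)
open import Data.Fin as F using (Fin; fromℕ; inject₁; punchIn; punchOut)
open import Data.Fin.Properties using (any?) renaming (_≟_ to _≟F_; _≤?_ to _≤?F_)
open import Data.Product using (Σ; ∃; _×_; _,_)
open import Data.Maybe using (Maybe; just; nothing)
open import Data.List using (List; foldr)
open import Data.List.Base using (allFin)
open import Relation.Binary.PropositionalEquality using (_≡_; _≢_)
open import Relation.Binary.Structures using (IsDecPartialOrder)
open import Relation.Nullary using (¬_; Dec; yes; no)
open import Relation.Nullary.Decidable using (_×-dec_; ¬?)
open import Function.Definitions using (Bijective)

record FinPoset (n : ℕ) : Set₁ where
  field
    _≼_ : Fin n → Fin n → Set
    isDecPartialOrder : IsDecPartialOrder _≡_ _≼_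
  open IsDecPartialOrder isDecPartialOrder public using () renaming (_≤?_ to _≼?_)

  _≺_ : Fin n → Fin n → Set
  a ≺ b = a ≼ b × a ≢ b

  _≺?_ : (a b : Fin n) → Dec (a ≺ b)
  a ≺? b = (a ≼? b) ×-dec ¬? (a ≟F b)

  _⋖_ : Fin n → Fin n → Set
  a ⋖ b = a ≺ b × ¬ (∃ λ c → a ≺ c × c ≺ b)

  _⋖?_ : (a b : Fin n) → Dec (a ⋖ b)
  a ⋖? b = (a ≺? b) ×-dec ¬? (any? (λ c → (a ≺? c) ×-dec (c ≺? b)))

open FinPoset public

-- The induced subposet P ∖ {p}, with ground set Fin m identified with
-- the elements of Fin (suc m) different from p via punchIn p.
_∖_ : ∀ {m} → FinPoset (suc m) → Fin (suc m) → FinPoset m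
_∖_ {m} P p = record
  { _≼_ = λ i j → _≼_ P (punchIn p i) (punchIn p j)
  ; isDecPartialOrder = record
    { isPartialOrder = record
      { isPreorder = record
        { isEquivalence = Eq.isEquivalence
        ; reflexive = λ { Eq.refl → IsDecPartialOrder.refl (isDecPartialOrder P) }
        ; trans = IsDecPartialOrder.trans (isDecPartialOrder P)
        }
      ; antisym = λ x y → Data.Fin.Properties.punchIn-injective p _ _
                            (IsDecPartialOrder.antisym (isDecPartialOrder P) x y)
      }
    ; _≟_ = _≟F_
    ; _≤?_ = λ i j → _≼?_ P (punchIn p i) (punchIn p j)
    }
  }
  where
  import Relation.Binary.PropositionalEquality as Eq
  import Data.Fin.Properties

IsLinExt : ∀ {k} → FinPoset k → (Fin k → Fin k) → Set
IsLinExt P f = Bijective _≡_ _≡_ f × (∀ x y → _≼_ P x y → f x F.≤ f y)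

extend : ∀ {m} → Fin (suc m) → (Fin m → Fin m) → Fin (suc m) → Fin (suc m)
extend {m} p f q with p ≟F q
... | yes _ = fromℕ m
... | no p≢q = inject₁ (f (punchOut p≢q))

swapVals : ∀ {k} → (Fin k → Fin k) → Fin k → Fin k → Fin k → Fin k
swapVals f a b x with x ≟F a | x ≟F b
... | yes _ | _ = f b
... | no _ | yes _ = f a
... | no _ | no _ = f x

minCover : ∀ {k} → FinPoset k → (Fin k → Fin k) → Fin k → Maybe (Fin k)
minCover {k} P f a = foldr pick nothing (allFin k)
  where
  pick : Fin k → Maybe (Fin k) → Maybe (Fin k)
  pick b acc with _⋖?_ P a b
  ... | no _ = acc
  ... | yes _ with acc
  ...   | nothing = just b
  ...   | just c with f b ≤?F f c
  ...     | yes _ = just b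
  ...     | no _ = just c

step : ∀ {m} → FinPoset (suc m) → (Fin (suc m) → Fin (suc m)) → Fin (suc m) → Fin (suc m)
step {m} P f with any? (λ a → f a ≟F fromℕ m)
... | no _ = f
... | yes (a , _) with minCover P f a
...   | nothing = f
...   | just b = swapVals f a b

iterate : ∀ {k} → ℕ → ((Fin k → Fin k) → (Fin k → Fin k)) → (Fin k → Fin k) → Fin k → Fin k
iterate zero g f = f
iterate (suc t) g f = iterate t g (g f)

-- The top value moves strictly up a saturated chain, so the loop
-- stops after fewer than n = suc m swaps; running `step` n times (it is the
-- identity once the top value sits on a maximal element) computes the result.
φ : ∀ {m} → FinPoset (suc m) → Fin (suc m) → (Fin m → Fin m) → Fin (suc m) → Fin (suc m)
φ {m} P p f = iterate (suc m) (step P) (extend p f)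

data OnChain {m} (P : FinPoset (suc m)) (f : Fin (suc m) → Fin (suc m)) : Fin (suc m) → Set where
  start : ∀ t → f t ≡ fromℕ m → OnChain P f t
  next  : ∀ t s → OnChain P f t → _⋖_ P s t
        → (∀ s' → _⋖_ P s' t → f s' F.≤ f s) → OnChain P f s

{-# OPTIONS --safe #-}
module Submission where

-- Under φ_p the top value slides up a saturated chain p = a₀ ⋖ a₁ ⋖ ⋯ ⋖ a_r, always
-- onto the upper cover with the smallest value, so the function stays an
-- order-preserving bijection away from the element holding the top value, and is a
-- linear extension once that element is maximal.  Each a_j receives the old value of
-- a_{j+1}, which exceeds the values of all other elements below a_{j+1}; hence in the
-- result a_j is the lower cover of a_{j+1} with the largest value, and a_r, …, a₀ is
-- an initial segment of the promotion chain, through p.  Conversely the promotion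
-- chain descends strictly, so each of its elements has a unique depth and a unique
-- predecessor on it: sliding the top value back down the chain to p inverts φ_p.

open import Defs hiding (_≼_; _≺_; _⋖_; _≼?_; _≺?_; _⋖?_; isDecPartialOrder)
open import Data.Nat as ℕ using (ℕ; zero; suc; z≤n)
import Data.Nat.Properties as ℕ
open import Data.Nat.Induction using (<-wellFounded)
open import Data.Fin using (Fin; _≤_; fromℕ; inject₁; punchIn; punchOut; lower₁; toℕ)
open import Data.Fin.Properties
  using ( _≟_; _≤?_; any?; ≤-refl; ≤-trans; ≤-antisym; ≤-poset; ≤fromℕ; toℕ-fromℕ; toℕ-injective
        ; toℕ-inject₁; toℕ-lower₁; fromℕ≢inject₁; inject₁-injective; inject₁-lower₁
        ; punchIn-injective; punchInᵢ≢i; punchOut-injective; punchOut-cong; punchIn-punchOut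
        ; punchOut-punchIn)
open import Data.Fin.Induction using (po-wellFounded)
open import Data.Fin.Subset as Subset using (Subset; ∣_∣)
open import Data.Fin.Subset.Properties using (p⊂q⇒∣p∣<∣q∣; ∣p∣≤n; x∈p⇒∣p-x∣<∣p∣)
open import Data.Vec using (tabulate)
open import Data.Vec.Properties using (lookup∘tabulate; lookup⇒[]=; []=⇒lookup)
open import Data.Product using (∃; _×_; _,_; proj₁; proj₂)
open import Data.Sum using (_⊎_; inj₁; inj₂)
open import Data.Maybe using (Maybe; just; nothing)
open import Data.List using (List; []; _∷_; foldr; allFin)
open import Data.List.Membership.Propositional using (_∈_)
open import Data.List.Membership.Propositional.Properties using (∈-allFin)
open import Data.List.Relation.Unary.Any using (here; there)
open import Function using (_∘_; id)
open import Function.Bundles using (_⇔_; mk⇔)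
open import Function.Definitions using (Bijective; Injective)
open import Function.Consequences.Propositional
  using (strictlySurjective⇒surjective; surjective⇒strictlySurjective)
import Function.Construct.Composition as Composition
open import Induction.WellFounded using (Acc; acc)
open import Relation.Binary.Bundles using (Poset)
open import Relation.Binary.Definitions using (tri<; tri≈; tri>)
open import Relation.Binary.PropositionalEquality
  using (_≡_; _≢_; _≗_; refl; sym; trans; cong; cong-app; subst; subst₂; ≢-sym; module ≡-Reasoning)
open import Relation.Binary.Structures using (IsDecPartialOrder)
import Relation.Binary.Properties.Poset as PosetProperties
import Relation.Binary.Reasoning.PartialOrder as PartialOrderReasoning
open import Relation.Nullary using (¬_; Dec; yes; no; contradiction)
open import Relation.Nullary.Decidable using (_×-dec_; does; dec-true)

bijective-resp-≗ : ∀ {A B : Set} {f g : A → B} →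
  f ≗ g → Bijective _≡_ _≡_ g → Bijective _≡_ _≡_ f
bijective-resp-≗ f≗g (g-inj , g-surj) =
  (λ {x} {y} fx≡fy → g-inj (trans (sym (f≗g x)) (trans fx≡fy (f≗g y))))
  , λ y → proj₁ (g-surj y) , λ z≡x → trans (f≗g _) (proj₂ (g-surj y) z≡x)

inject₁-mono : ∀ {n} {i j : Fin n} → i ≤ j → inject₁ i ≤ inject₁ j
inject₁-mono {i = i} {j} = subst₂ ℕ._≤_ (sym (toℕ-inject₁ i)) (sym (toℕ-inject₁ j))

iterate-fixedPoint : ∀ {k} {F : (Fin k → Fin k) → Fin k → Fin k} {g} t →
  F g ≡ g → iterate t F g ≡ g
iterate-fixedPoint zero    Fg≡g = refl
iterate-fixedPoint (suc t) Fg≡g rewrite Fg≡g = iterate-fixedPoint t Fg≡g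

module _ {k : ℕ} where

  swapVals-≡ˡ : ∀ (g : Fin k → Fin k) a b → swapVals g a b a ≡ g b
  swapVals-≡ˡ g a b with a ≟ a
  ... | yes _   = refl
  ... | no a≢a = contradiction refl a≢a

  swapVals-≡ʳ : ∀ (g : Fin k → Fin k) a b → swapVals g a b b ≡ g a
  swapVals-≡ʳ g a b with b ≟ a | b ≟ b
  ... | yes refl | _      = refl
  ... | no _     | yes _  = refl
  ... | no _     | no b≢b = contradiction refl b≢b

  swapVals-≢ : ∀ (g : Fin k → Fin k) {a b x} → x ≢ a → x ≢ b → swapVals g a b x ≡ g x
  swapVals-≢ g {a} {b} {x} x≢a x≢b with x ≟ a | x ≟ b
  ... | yes x≡a | _       = contradiction x≡a x≢a
  ... | no _    | yes x≡b = contradiction x≡b x≢b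
  ... | no _    | no _    = refl

  swapVals-cong : ∀ {g h : Fin k → Fin k} a b → g ≗ h → swapVals g a b ≗ swapVals h a b
  swapVals-cong a b g≗h x with x ≟ a | x ≟ b
  ... | yes _ | _     = g≗h b
  ... | no _  | yes _ = g≗h a
  ... | no _  | no _  = g≗h x

  swapVals-involutive : ∀ (g : Fin k → Fin k) a b → swapVals (swapVals g a b) a b ≗ g
  swapVals-involutive g a b x with x ≟ a | x ≟ b
  ... | yes refl | _        = swapVals-≡ʳ g a b
  ... | no _     | yes refl = swapVals-≡ˡ g a b
  ... | no x≢a   | no x≢b   = swapVals-≢ g x≢a x≢b

  swapVals-cancel : ∀ {g h : Fin k → Fin k} a b → swapVals g a b ≗ swapVals h a b → g ≗ h
  swapVals-cancel {g} {h} a b e x = begin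
    g x                                   ≡⟨ swapVals-involutive g a b x ⟨
    swapVals (swapVals g a b) a b x       ≡⟨ swapVals-cong a b e x ⟩
    swapVals (swapVals h a b) a b x       ≡⟨ swapVals-involutive h a b x ⟩
    h x                                   ∎
    where open ≡-Reasoning

  swapVals-∘ : ∀ (g : Fin k → Fin k) a b → swapVals g a b ≗ g ∘ swapVals id a b
  swapVals-∘ g a b x with x ≟ a | x ≟ b
  ... | yes _ | _     = refl
  ... | no _  | yes _ = refl
  ... | no _  | no _  = refl

  swapVals-bijective : ∀ {g : Fin k → Fin k} a b →
    Bijective _≡_ _≡_ g → Bijective _≡_ _≡_ (swapVals g a b)
  swapVals-bijective {g} a b g-bij = bijective-resp-≗ (swapVals-∘ g a b)
    (Composition.bijective _≡_ _≡_ _≡_ transposition-bijective g-bij)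
    where
    τ : Fin k → Fin k
    τ = swapVals id a b
    τ-involutive : ∀ x → τ (τ x) ≡ x
    τ-involutive x = trans (sym (swapVals-∘ τ a b x)) (swapVals-involutive id a b x)
    transposition-bijective : Bijective _≡_ _≡_ τ
    transposition-bijective =
      (λ {x} {y} τx≡τy → trans (sym (τ-involutive x)) (trans (cong τ τx≡τy) (τ-involutive y)))
      , strictlySurjective⇒surjective λ y → τ y , τ-involutive y

module FinPosetProperties {k : ℕ} (P : FinPoset k) where
  open FinPoset P
  open IsDecPartialOrder isDecPartialOrder public
    using (isPartialOrder) renaming (refl to ≼-refl; trans to ≼-trans)

  poset : Poset _ _ _
  poset = record { isPartialOrder = isPartialOrder }

  open PosetProperties poset public
    using () renaming (<-irrefl to ≺-irrefl; <-trans to ≺-trans; <⇒≱ to ≺⇒⋡)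

  upSet : Fin k → Subset k
  upSet a = tabulate λ c → does (a ≼? c)

  upSize : Fin k → ℕ
  upSize a = ∣ upSet a ∣

  ∈-upSet⁺ : ∀ {a c} → a ≼ c → c Subset.∈ upSet a
  ∈-upSet⁺ {a} {c} a≼c = lookup⇒[]= c _ (trans (lookup∘tabulate _ c) (dec-true (a ≼? c) a≼c))

  ∈-upSet⁻ : ∀ {a c} → c Subset.∈ upSet a → a ≼ c
  ∈-upSet⁻ {a} {c} c∈↑a with a ≼? c | trans (sym (lookup∘tabulate _ c)) ([]=⇒lookup c∈↑a)
  ... | yes a≼c | _ = a≼c
  ... | no _ | ()

  upSize-≺ : ∀ {a b} → a ≺ b → upSize b ℕ.< upSize a
  upSize-≺ {a} a≺b = p⊂q⇒∣p∣<∣q∣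
    ( (λ c∈↑b → ∈-upSet⁺ (≼-trans (proj₁ a≺b) (∈-upSet⁻ c∈↑b)))
    , a , ∈-upSet⁺ ≼-refl , λ a∈↑b → ≺⇒⋡ a≺b (∈-upSet⁻ a∈↑b))

  upSize-positive : ∀ a → 0 ℕ.< upSize a
  upSize-positive a = ℕ.≤-<-trans z≤n (x∈p⇒∣p-x∣<∣p∣ (∈-upSet⁺ {a} ≼-refl))

  upSize≤ : ∀ a → upSize a ℕ.≤ k
  upSize≤ a = ∣p∣≤n (upSet a)

  upperCover-below : ∀ {x y} → x ≺ y → ∃ λ c → x ⋖ c × c ≼ y
  upperCover-below {x} {y} = go y (po-wellFounded isPartialOrder y)
    where
    go : ∀ y → Acc _≺_ y → x ≺ y → ∃ λ c → x ⋖ c × c ≼ y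
    go y (acc below) x≺y with any? (λ c → (x ≺? c) ×-dec (c ≺? y))
    ... | no nothing-between = y , (x≺y , nothing-between) , ≼-refl
    ... | yes (c , x≺c , c≺y) with go c (below c≺y) x≺c
    ...   | d , x⋖d , d≼c = d , x⋖d , ≼-trans d≼c (proj₁ c≺y)

  lowerCover-above : ∀ {x y} → x ≺ y → ∃ λ c → x ≼ c × c ⋖ y
  lowerCover-above {x} {y} = go x (<-wellFounded (upSize x))
    where
    go : ∀ x → Acc ℕ._<_ (upSize x) → x ≺ y → ∃ λ c → x ≼ c × c ⋖ y
    go x (acc below) x≺y with any? (λ c → (x ≺? c) ×-dec (c ≺? y))
    ... | no nothing-between = x , ≼-refl , (x≺y , nothing-between)
    ... | yes (c , x≺c , c≺y) with go c (below (upSize-≺ x≺c)) c≺y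
    ...   | d , c≼d , d⋖y = d , ≼-trans (proj₁ x≺c) c≼d , d⋖y

  Maximal : Fin k → Set
  Maximal a = ∀ b → ¬ a ⋖ b

  IsMinUpperCover : (Fin k → Fin k) → Fin k → Fin k → Set
  IsMinUpperCover f a b = a ⋖ b × (∀ c → a ⋖ c → f b ≤ f c)

  IsMaxLowerCover : (Fin k → Fin k) → Fin k → Fin k → Set
  IsMaxLowerCover f a b = a ⋖ b × (∀ c → c ⋖ b → f c ≤ f a)

  data MinCoverIn (f : Fin k → Fin k) (a : Fin k) (xs : List (Fin k)) : Maybe (Fin k) → Set where
    none : (∀ {b} → b ∈ xs → ¬ a ⋖ b) → MinCoverIn f a xs nothing
    some : ∀ {b} → a ⋖ b → (∀ {c} → c ∈ xs → a ⋖ c → f b ≤ f c) → MinCoverIn f a xs (just b)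

  -- The step function folded by minCover is local to its definition; matching that
  -- definition against foldr recovers it.
  private
    foldStep : ∀ {A B : Set} {h : A → B → B} {e : B} {xs : List A} (r : B) →
      r ≡ foldr h e xs → A → B → B
    foldStep {h = h} _ _ = h

  minCoverStep : (Fin k → Fin k) → Fin k → Fin k → Maybe (Fin k) → Maybe (Fin k)
  minCoverStep f a = foldStep {e = nothing} {xs = allFin k} (minCover P f a) refl

  foldr-minCoverStep : ∀ f a xs → MinCoverIn f a xs (foldr (minCoverStep f a) nothing xs)
  foldr-minCoverStep f a [] = none λ ()
  foldr-minCoverStep f a (x ∷ xs)
    with a ⋖? x | foldr (minCoverStep f a) nothing xs | foldr-minCoverStep f a xs
  ... | no a⋖̸x | _ | none ns = none λ { (here refl) → a⋖̸x ; (there b∈xs) → ns b∈xs }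
  ... | no a⋖̸x | _ | some a⋖b min =
    some a⋖b λ { (here refl) a⋖x → contradiction a⋖x a⋖̸x ; (there c∈xs) → min c∈xs }
  ... | yes a⋖x | _ | none ns =
    some a⋖x λ { (here refl) _ → ≤-refl ; (there c∈xs) a⋖c → contradiction a⋖c (ns c∈xs) }
  ... | yes a⋖x | just b | some a⋖b min with f x ≤? f b
  ...   | yes fx≤fb =
    some a⋖x λ { (here refl) _ → ≤-refl ; (there c∈xs) a⋖c → ≤-trans fx≤fb (min c∈xs a⋖c) }
  ...   | no fx≰fb  =
    some a⋖b λ { (here refl) _ → ℕ.<⇒≤ (ℕ.≰⇒> fx≰fb) ; (there c∈xs) → min c∈xs }

  minCover-view : ∀ f a → MinCoverIn f a (allFin k) (minCover P f a)
  minCover-view f a = foldr-minCoverStep f a (allFin k)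

module Slide {m : ℕ} (P : FinPoset (suc m)) where
  open FinPoset P using (_≼_; _≺_; _⋖_)
  open FinPosetProperties P
  module ≤-Reasoning = PartialOrderReasoning (≤-poset (suc m))

  top : Fin (suc m)
  top = fromℕ m

  record IsLinExtExcept (g : Fin (suc m) → Fin (suc m)) (a : Fin (suc m)) : Set where
    field
      bijective : Bijective _≡_ _≡_ g
      top-at    : g a ≡ top
      monotone  : ∀ {x y} → x ≼ y → x ≢ a → y ≢ a → g x ≤ g y

    injective : Injective _≡_ _≡_ g
    injective = proj₁ bijective

    top-unique : ∀ {x} → g x ≡ top → x ≡ a
    top-unique gx≡top = injective (trans gx≡top (sym top-at))

  open IsLinExtExcept

  linExt-resp-≗ : ∀ {g h} → h ≗ g → IsLinExt P g → IsLinExt P h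
  linExt-resp-≗ h≗g (g-bij , g-mono) =
    bijective-resp-≗ h≗g g-bij , λ x y x≼y → subst₂ _≤_ (sym (h≗g x)) (sym (h≗g y)) (g-mono x y x≼y)

  linExt⇒except : ∀ {g a} → IsLinExt P g → g a ≡ top → IsLinExtExcept g a
  linExt⇒except (g-bij , g-mono) ga≡top = record
    { bijective = g-bij ; top-at = ga≡top ; monotone = λ x≼y _ _ → g-mono _ _ x≼y }

  top-maximal : ∀ {g a} → IsLinExt P g → g a ≡ top → Maximal a
  top-maximal {g} {a} (g-bij , g-mono) ga≡top b (a≺b , _) =
    proj₂ a≺b (proj₁ g-bij (≤-antisym (g-mono a b (proj₁ a≺b)) gb≤ga))
    where
    gb≤ga : g b ≤ g a
    gb≤ga = subst (g b ≤_) (sym ga≡top) (≤fromℕ (g b))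

  except⇒linExt : ∀ {g a} → IsLinExtExcept g a → Maximal a → IsLinExt P g
  except⇒linExt {g} {a} I a-max = bijective I , monotone′
    where
    monotone′ : ∀ x y → x ≼ y → g x ≤ g y
    monotone′ x y x≼y with x ≟ a | y ≟ a
    ... | _        | yes refl = subst (g x ≤_) (sym (top-at I)) (≤fromℕ (g x))
    ... | no x≢a   | no y≢a   = monotone I x≼y x≢a y≢a
    ... | yes refl | no y≢a   with upperCover-below (x≼y , ≢-sym y≢a)
    ...   | c , a⋖c , _ = contradiction a⋖c (a-max c)

  slideUp : ∀ {g a b} → IsLinExtExcept g a → IsMinUpperCover g a b →
    IsLinExtExcept (swapVals g a b) b
  slideUp {g} {a} {b} I (a⋖b , b-min) = record
    { bijective = swapVals-bijective a b (bijective I)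
    ; top-at    = trans (swapVals-≡ʳ g a b) (top-at I)
    ; monotone  = monotone′
    }
    where
    open ≤-Reasoning
    b≢a : b ≢ a
    b≢a = ≢-sym (proj₂ (proj₁ a⋖b))
    monotone′ : ∀ {x y} → x ≼ y → x ≢ b → y ≢ b → swapVals g a b x ≤ swapVals g a b y
    monotone′ {x} {y} x≼y x≢b y≢b with x ≟ a | x ≟ b | y ≟ a | y ≟ b
    ... | _        | _       | _        | yes y≡b = contradiction y≡b y≢b
    ... | no _     | yes x≡b | _        | _       = contradiction x≡b x≢b
    ... | yes refl | _       | yes refl | _       = ≤-refl
    ... | no x≢a   | no _    | yes refl | no _    =
      monotone I (≼-trans x≼y (proj₁ (proj₁ a⋖b))) x≢a b≢a
    ... | no x≢a   | no _    | no y≢a   | no _    = monotone I x≼y x≢a y≢a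
    ... | yes refl | _       | no y≢a   | no _    with upperCover-below (x≼y , ≢-sym y≢a)
    ...   | c , a⋖c , c≼y = begin
      g b ≤⟨ b-min c a⋖c ⟩
      g c ≤⟨ monotone I c≼y (≢-sym (proj₂ (proj₁ a⋖c))) y≢a ⟩
      g y ∎

  slideDown : ∀ {g a b} → IsLinExtExcept g b → IsMaxLowerCover g a b →
    IsLinExtExcept (swapVals g a b) a
  slideDown {g} {a} {b} I (a⋖b , a-max) = record
    { bijective = swapVals-bijective a b (bijective I)
    ; top-at    = trans (swapVals-≡ˡ g a b) (top-at I)
    ; monotone  = monotone′
    }
    where
    open ≤-Reasoning
    a≢b : a ≢ b
    a≢b = proj₂ (proj₁ a⋖b)
    monotone′ : ∀ {x y} → x ≼ y → x ≢ a → y ≢ a → swapVals g a b x ≤ swapVals g a b y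
    monotone′ {x} {y} x≼y x≢a y≢a with x ≟ a | x ≟ b | y ≟ a | y ≟ b
    ... | yes x≡a | _        | _       | _        = contradiction x≡a x≢a
    ... | _       | _        | yes y≡a | _        = contradiction y≡a y≢a
    ... | no _    | yes refl | no _    | yes refl = ≤-refl
    ... | no _    | yes refl | no _    | no y≢b   =
      monotone I (≼-trans (proj₁ (proj₁ a⋖b)) x≼y) a≢b y≢b
    ... | no _    | no x≢b   | no _    | no y≢b   = monotone I x≼y x≢b y≢b
    ... | no _    | no x≢b   | no _    | yes refl with lowerCover-above (x≼y , x≢b)
    ...   | c , x≼c , c⋖b = begin
      g x ≤⟨ monotone I x≼c x≢b (proj₂ (proj₁ c⋖b)) ⟩
      g c ≤⟨ a-max c c⋖b ⟩
      g a ∎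

  slideDown-minUpperCover : ∀ {g a b} → IsLinExtExcept g b → a ⋖ b →
    IsMinUpperCover (swapVals g a b) a b
  slideDown-minUpperCover {g} {a} {b} I a⋖b = a⋖b , b-min
    where
    b-min : ∀ c → a ⋖ c → swapVals g a b b ≤ swapVals g a b c
    b-min c a⋖c = cases (c ≟ b)
      where
      open ≤-Reasoning
      cases : Dec (c ≡ b) → swapVals g a b b ≤ swapVals g a b c
      cases (yes refl) = ≤-refl
      cases (no c≢b)   = begin
        swapVals g a b b ≡⟨ swapVals-≡ʳ g a b ⟩
        g a              ≤⟨ monotone I (proj₁ (proj₁ a⋖c)) (proj₂ (proj₁ a⋖b)) c≢b ⟩
        g c              ≡⟨ swapVals-≢ g (≢-sym (proj₂ (proj₁ a⋖c))) c≢b ⟨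
        swapVals g a b c ∎

  -- Run g a h: the loop of φ, started from g with the top value on a, halts with h.
  data Run : (Fin (suc m) → Fin (suc m)) → Fin (suc m) → (Fin (suc m) → Fin (suc m)) → Set where
    stop  : ∀ {g a h} → Maximal a → h ≗ g → Run g a h
    slide : ∀ {g a b h} → IsMinUpperCover g a b → Run (swapVals g a b) b h → Run g a h

  Run-respˡ : ∀ {g g′ a h} → g ≗ g′ → Run g a h → Run g′ a h
  Run-respˡ g≗g′ (stop a-max h≗g) = stop a-max λ x → trans (h≗g x) (g≗g′ x)
  Run-respˡ {a = a} g≗g′ (slide {b = b} (a⋖b , b-min) r) =
    slide (a⋖b , λ c a⋖c → subst₂ _≤_ (g≗g′ b) (g≗g′ c) (b-min c a⋖c))
          (Run-respˡ (swapVals-cong a b g≗g′) r)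

  step-view : ∀ {g a} → IsLinExtExcept g a →
    (Maximal a × step P g ≡ g) ⊎ (∃ λ b → IsMinUpperCover g a b × step P g ≡ swapVals g a b)
  step-view {g} {a} I with any? (λ x → g x ≟ fromℕ m)
  ... | no no-top = contradiction (a , top-at I) no-top
  ... | yes (a′ , ga′≡top) with top-unique I ga′≡top
  ...   | refl with minCover P g a | minCover-view g a
  ...     | nothing | none no-cover  = inj₁ ((λ b → no-cover (∈-allFin b)) , refl)
  ...     | just b  | some a⋖b b-min = inj₂ (b , (a⋖b , λ c → b-min (∈-allFin c)) , refl)

  iterate-Run : ∀ {g a} t → IsLinExtExcept g a → upSize a ℕ.≤ t → Run g a (iterate t (step P) g)
  iterate-Run zero I ↑a≤0 = contradiction ↑a≤0 (ℕ.<⇒≱ (upSize-positive _))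
  iterate-Run (suc t) I ↑a≤1+t with step-view I
  ... | inj₁ (a-max , step≡g) = stop a-max (cong-app (iterate-fixedPoint (suc t) step≡g))
  ... | inj₂ (b , b-min , step≡swap) rewrite step≡swap =
    slide b-min (iterate-Run t (slideUp I b-min)
      (ℕ.s≤s⁻¹ (ℕ.<-≤-trans (upSize-≺ (proj₁ (proj₁ b-min))) ↑a≤1+t)))

  Run-fixes-outside : ∀ {g a h c} → Run g a h → ¬ a ≼ c → h c ≡ g c
  Run-fixes-outside (stop _ h≗g) _ = h≗g _
  Run-fixes-outside {g} (slide (((a≼b , _) , _) , _) r) a⋠c =
    trans (Run-fixes-outside r (a⋠c ∘ ≼-trans a≼b))
          (swapVals-≢ g (λ { refl → a⋠c ≼-refl }) λ { refl → a⋠c a≼b })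

  Run-linExt : ∀ {g a h} → IsLinExtExcept g a → Run g a h → IsLinExt P h
  Run-linExt I (stop a-max h≗g) = linExt-resp-≗ h≗g (except⇒linExt I a-max)
  Run-linExt I (slide b-min r)  = Run-linExt (slideUp I b-min) r

  Run-maxLowerCover : ∀ {g a b h} → IsLinExtExcept g a → IsMinUpperCover g a b →
    Run (swapVals g a b) b h → IsMaxLowerCover h a b
  Run-maxLowerCover {g} {a} {b} {h} I (a⋖b , _) r = a⋖b , a-max
    where
    open ≤-Reasoning
    a-max : ∀ c → c ⋖ b → h c ≤ h a
    a-max c c⋖b with c ≟ a
    ... | yes refl = ≤-refl
    ... | no c≢a   = begin
      h c              ≡⟨ Run-fixes-outside r (≺⇒⋡ (proj₁ c⋖b)) ⟩
      swapVals g a b c ≡⟨ swapVals-≢ g c≢a (proj₂ (proj₁ c⋖b)) ⟩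
      g c              ≤⟨ monotone I (proj₁ (proj₁ c⋖b)) c≢a (≢-sym (proj₂ (proj₁ a⋖b))) ⟩
      g b              ≡⟨ swapVals-≡ˡ g a b ⟨
      swapVals g a b a ≡⟨ Run-fixes-outside r (≺⇒⋡ (proj₁ a⋖b)) ⟨
      h a              ∎

  -- ChainAt h i x: x is the element at depth i of the promotion chain of h (t_{i+1}).
  data ChainAt (h : Fin (suc m) → Fin (suc m)) : ℕ → Fin (suc m) → Set where
    start : ∀ {t} → h t ≡ top → ChainAt h 0 t
    next  : ∀ {i s t} → ChainAt h i t → IsMaxLowerCover h s t → ChainAt h (suc i) s

  onChain⇒chainAt : ∀ {h x} → OnChain P h x → ∃ λ i → ChainAt h i x
  onChain⇒chainAt (start _ ht≡top) = 0 , start ht≡top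
  onChain⇒chainAt (next _ _ c s⋖t s-max) with onChain⇒chainAt c
  ... | i , c′ = suc i , next c′ (s⋖t , s-max)

  chainAt⇒onChain : ∀ {h i x} → ChainAt h i x → OnChain P h x
  chainAt⇒onChain (start ht≡top)        = start _ ht≡top
  chainAt⇒onChain (next c (s⋖t , s-max)) = next _ _ (chainAt⇒onChain c) s⋖t s-max

  chainAt-resp-≗ : ∀ {g h i x} → h ≗ g → ChainAt g i x → ChainAt h i x
  chainAt-resp-≗ h≗g (start gt≡top) = start (trans (h≗g _) gt≡top)
  chainAt-resp-≗ h≗g (next {s = s} c (s⋖t , s-max)) =
    next (chainAt-resp-≗ h≗g c)
         (s⋖t , λ s′ s′⋖t → subst₂ _≤_ (sym (h≗g s′)) (sym (h≗g s)) (s-max s′ s′⋖t))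

  module _ {h : Fin (suc m) → Fin (suc m)} (h-inj : Injective _≡_ _≡_ h) where

    chainAt-unique : ∀ {i x y} → ChainAt h i x → ChainAt h i y → x ≡ y
    chainAt-unique (start hx≡top) (start hy≡top) = h-inj (trans hx≡top (sym hy≡top))
    chainAt-unique {x = x} {y} (next cx (x⋖t , x-max)) (next cy (y⋖t′ , y-max))
      with chainAt-unique cx cy
    ... | refl = h-inj (≤-antisym (y-max x x⋖t) (x-max y y⋖t′))

    chainAt-descending : ∀ {i j x y} → ChainAt h i x → ChainAt h j y → i ℕ.< j → y ≺ x
    chainAt-descending cx (next cy (y⋖t , _)) i<1+j with ℕ.m≤n⇒m<n∨m≡n (ℕ.s≤s⁻¹ i<1+j)
    ... | inj₁ i<j = ≺-trans (proj₁ y⋖t) (chainAt-descending cx cy i<j)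
    ... | inj₂ refl with chainAt-unique cx cy
    ...   | refl = proj₁ y⋖t

    chainAt-depth-unique : ∀ {i j x} → ChainAt h i x → ChainAt h j x → i ≡ j
    chainAt-depth-unique {i} {j} ci cj with ℕ.<-cmp i j
    ... | tri< i<j _ _ = contradiction (chainAt-descending ci cj i<j) (≺-irrefl refl)
    ... | tri≈ _ i≡j _ = i≡j
    ... | tri> _ _ j<i = contradiction (chainAt-descending cj ci j<i) (≺-irrefl refl)

  Run-chainAt : ∀ {g a h} → IsLinExtExcept g a → Run g a h → ∃ λ i → ChainAt h i a
  Run-chainAt I (stop _ h≗g) = 0 , start (trans (h≗g _) (top-at I))
  Run-chainAt I (slide b-min r) with Run-chainAt (slideUp I b-min) r
  ... | i , c = suc i , next c (Run-maxLowerCover I b-min r)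

  Run-deterministic : ∀ {g a h₁ h₂} → IsLinExtExcept g a → Run g a h₁ → Run g a h₂ → h₁ ≗ h₂
  Run-deterministic I (stop _ h₁≗g) (stop _ h₂≗g) x = trans (h₁≗g x) (sym (h₂≗g x))
  Run-deterministic I (stop a-max _) (slide (a⋖b , _) _) = contradiction a⋖b (a-max _)
  Run-deterministic I (slide (a⋖b , _) _) (stop a-max _) = contradiction a⋖b (a-max _)
  Run-deterministic I (slide {b = b₁} (a⋖b₁ , b₁-min) r₁) (slide {b = b₂} (a⋖b₂ , b₂-min) r₂)
    with injective I (≤-antisym (b₁-min b₂ a⋖b₂) (b₂-min b₁ a⋖b₁))
  ... | refl = Run-deterministic (slideUp I (a⋖b₁ , b₁-min)) r₁ r₂

  Run-injective : ∀ {g₁ g₂ a h₁ h₂} → IsLinExtExcept g₁ a → IsLinExtExcept g₂ a →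
    Run g₁ a h₁ → Run g₂ a h₂ → h₁ ≗ h₂ → g₁ ≗ g₂
  Run-injective I₁ I₂ (stop _ h₁≗g₁) (stop _ h₂≗g₂) h₁≗h₂ x =
    trans (sym (h₁≗g₁ x)) (trans (h₁≗h₂ x) (h₂≗g₂ x))
  Run-injective I₁ I₂ (stop a-max _) (slide (a⋖b , _) _) _ = contradiction a⋖b (a-max _)
  Run-injective I₁ I₂ (slide (a⋖b , _) _) (stop a-max _) _ = contradiction a⋖b (a-max _)
  -- The first slide target is the predecessor of a on the promotion chain of the
  -- result, so it is determined by the result.
  Run-injective {a = a} I₁ I₂ (slide {b = b₁} b₁-min r₁) (slide {b = b₂} b₂-min r₂) h₁≗h₂
    with Run-linExt I₁ (slide b₁-min r₁) | Run-chainAt (slideUp I₁ b₁-min) r₁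
       | Run-chainAt (slideUp I₂ b₂-min) r₂
  ... | (h₁-inj , _) , _ | i , c₁ | j , c₂
    with chainAt-depth-unique h₁-inj (next c₁ (Run-maxLowerCover I₁ b₁-min r₁))
           (chainAt-resp-≗ h₁≗h₂ (next c₂ (Run-maxLowerCover I₂ b₂-min r₂)))
  ... | refl with chainAt-unique h₁-inj c₁ (chainAt-resp-≗ h₁≗h₂ c₂)
  ...   | refl =
    swapVals-cancel a b₁ (Run-injective (slideUp I₁ b₁-min) (slideUp I₂ b₂-min) r₁ r₂ h₁≗h₂)

  chainAt⇒Run : ∀ {l i a} → IsLinExt P l → ChainAt l i a →
    ∃ λ g → IsLinExtExcept g a × Run g a l
  chainAt⇒Run l-lin (start lt≡top) =
    _ , linExt⇒except l-lin lt≡top , stop (top-maximal l-lin lt≡top) (λ _ → refl)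
  chainAt⇒Run l-lin (next {s = a} {t} c (a⋖t , a-max)) with chainAt⇒Run l-lin c
  ... | g , I , r =
    swapVals g a t , slideDown I (a⋖t , a-max′) ,
    slide (slideDown-minUpperCover I a⋖t) (Run-respˡ (sym ∘ swapVals-involutive g a t) r)
    where
    a-max′ : ∀ c → c ⋖ t → g c ≤ g a
    a-max′ c c⋖t = subst₂ _≤_ (Run-fixes-outside r (≺⇒⋡ (proj₁ c⋖t)))
                              (Run-fixes-outside r (≺⇒⋡ (proj₁ a⋖t))) (a-max c c⋖t)

  ≢top⇒≢toℕ : ∀ {z} → z ≢ top → m ≢ toℕ z
  ≢top⇒≢toℕ z≢top m≡z = z≢top (toℕ-injective (trans (sym m≡z) (sym (toℕ-fromℕ m))))

  module _ (p : Fin (suc m)) where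

    extend-p : ∀ f → extend p f p ≡ top
    extend-p f with p ≟ p
    ... | yes _   = refl
    ... | no p≢p = contradiction refl p≢p

    extend-≢ : ∀ f {x} (p≢x : p ≢ x) → extend p f x ≡ inject₁ (f (punchOut p≢x))
    extend-≢ f {x} p≢x with p ≟ x
    ... | yes p≡x = contradiction p≡x p≢x
    ... | no _    = cong (inject₁ ∘ f) (punchOut-cong p refl)

    extend-punchIn : ∀ f y → extend p f (punchIn p y) ≡ inject₁ (f y)
    extend-punchIn f y =
      trans (extend-≢ f (≢-sym (punchInᵢ≢i p y))) (cong (inject₁ ∘ f) (punchOut-punchIn p))

    extend-injective : ∀ {f g} → extend p f ≗ extend p g → f ≗ g
    extend-injective {f} {g} e y =
      inject₁-injective (trans (sym (extend-punchIn f y)) (trans (e _) (extend-punchIn g y)))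

    extend-isLinExtExcept : ∀ {f} → IsLinExt (P ∖ p) f → IsLinExtExcept (extend p f) p
    extend-isLinExtExcept {f} ((f-inj , f-surj) , f-mono) = record
      { bijective = ext-inj , strictlySurjective⇒surjective ext-surj
      ; top-at    = extend-p f
      ; monotone  = ext-mono
      }
      where
      ext-inj : Injective _≡_ _≡_ (extend p f)
      ext-inj {x} {y} e with p ≟ x | p ≟ y
      ... | yes refl | yes refl = refl
      ... | yes refl | no _     = contradiction e fromℕ≢inject₁
      ... | no _     | yes refl = contradiction (sym e) fromℕ≢inject₁
      ... | no p≢x   | no p≢y   = punchOut-injective p≢x p≢y (f-inj (inject₁-injective e))
      ext-surj : ∀ z → ∃ λ x → extend p f x ≡ z
      ext-surj z with z ≟ top
      ... | yes refl  = p , extend-p f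
      ... | no z≢top with surjective⇒strictlySurjective f-surj (lower₁ z (≢top⇒≢toℕ z≢top))
      ...   | y , fy≡z = punchIn p y ,
        trans (extend-punchIn f y) (trans (cong inject₁ fy≡z) (inject₁-lower₁ z _))
      ext-mono : ∀ {x y} → x ≼ y → x ≢ p → y ≢ p → extend p f x ≤ extend p f y
      ext-mono x≼y x≢p y≢p =
        subst₂ _≤_ (sym (extend-≢ f (≢-sym x≢p))) (sym (extend-≢ f (≢-sym y≢p)))
          (inject₁-mono (f-mono _ _
            (subst₂ _≼_ (sym (punchIn-punchOut _)) (sym (punchIn-punchOut _)) x≼y)))

    restrict : ∀ {g} → IsLinExtExcept g p → Fin m → Fin m
    restrict {g} I y = lower₁ (g (punchIn p y)) (≢top⇒≢toℕ (punchInᵢ≢i p y ∘ top-unique I))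

    inject₁-restrict : ∀ {g} (I : IsLinExtExcept g p) y → inject₁ (restrict I y) ≡ g (punchIn p y)
    inject₁-restrict I y = inject₁-lower₁ _ _

    extend-restrict : ∀ {g} (I : IsLinExtExcept g p) → extend p (restrict I) ≗ g
    extend-restrict {g} I x with p ≟ x
    ... | yes refl = sym (top-at I)
    ... | no p≢x   = trans (inject₁-restrict I _) (cong g (punchIn-punchOut p≢x))

    restrict-isLinExt : ∀ {g} (I : IsLinExtExcept g p) → IsLinExt (P ∖ p) (restrict I)
    restrict-isLinExt {g} I = (r-inj , strictlySurjective⇒surjective r-surj) , r-mono
      where
      r-inj : Injective _≡_ _≡_ (restrict I)
      r-inj {y} {y′} e = punchIn-injective p y y′ (injective I
        (trans (sym (inject₁-restrict I y)) (trans (cong inject₁ e) (inject₁-restrict I y′))))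
      r-surj : ∀ v → ∃ λ y → restrict I y ≡ v
      r-surj v with surjective⇒strictlySurjective (proj₂ (bijective I)) (inject₁ v)
      ... | x , gx≡v with p ≟ x
      ...   | yes refl = contradiction (trans (sym (top-at I)) gx≡v) fromℕ≢inject₁
      ...   | no p≢x   = punchOut p≢x , inject₁-injective
        (trans (inject₁-restrict I _) (trans (cong g (punchIn-punchOut p≢x)) gx≡v))
      r-mono : ∀ y y′ → punchIn p y ≼ punchIn p y′ → restrict I y ≤ restrict I y′
      r-mono y y′ y≼y′ = subst₂ ℕ._≤_ (sym (toℕ-lower₁ _ _)) (sym (toℕ-lower₁ _ _))
        (monotone I y≼y′ (punchInᵢ≢i p y) (punchInᵢ≢i p y′))

    φ-Run : ∀ {f} → IsLinExt (P ∖ p) f → Run (extend p f) p (φ P p f)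
    φ-Run f-lin = iterate-Run (suc m) (extend-isLinExtExcept f-lin) (upSize≤ p)

lemma3p3 : ∀ {m} (P : FinPoset (suc m)) (p : Fin (suc m)) →
    -- φ_p maps L(P ∖ {p}) into L(P)
    (∀ f → IsLinExt (P ∖ p) f → IsLinExt P (φ P p f))
    -- φ_p is injective
    × (∀ f g → IsLinExt (P ∖ p) f → IsLinExt (P ∖ p) g →
         (∀ x → φ P p f x ≡ φ P p g x) → ∀ y → f y ≡ g y)
    -- image of φ_p = linear extensions whose promotion chain passes through p
    × (∀ l → IsLinExt P l →
         (OnChain P l p ⇔ ∃ (λ f → IsLinExt (P ∖ p) f × (∀ x → φ P p f x ≡ l x))))
lemma3p3 P p = φ-isLinExt , φ-injective , φ-image
  where
  open Slide P

  φ-isLinExt : ∀ f → IsLinExt (P ∖ p) f → IsLinExt P (φ P p f)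
  φ-isLinExt f f-lin = Run-linExt (extend-isLinExtExcept p f-lin) (φ-Run p f-lin)

  φ-injective : ∀ f g → IsLinExt (P ∖ p) f → IsLinExt (P ∖ p) g →
    (∀ x → φ P p f x ≡ φ P p g x) → ∀ y → f y ≡ g y
  φ-injective f g f-lin g-lin = extend-injective p ∘
    Run-injective (extend-isLinExtExcept p f-lin) (extend-isLinExtExcept p g-lin)
                  (φ-Run p f-lin) (φ-Run p g-lin)

  φ-image : ∀ l → IsLinExt P l →
    OnChain P l p ⇔ ∃ (λ f → IsLinExt (P ∖ p) f × (∀ x → φ P p f x ≡ l x))
  φ-image l l-lin = mk⇔ to from
    where
    to : OnChain P l p → ∃ (λ f → IsLinExt (P ∖ p) f × (∀ x → φ P p f x ≡ l x))
    to p-on-chain with chainAt⇒Run l-lin (proj₂ (onChain⇒chainAt p-on-chain))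
    ... | g , I , r = restrict p I , f-lin ,
      Run-deterministic (extend-isLinExtExcept p f-lin) (φ-Run p f-lin)
                        (Run-respˡ (sym ∘ extend-restrict p I) r)
      where
      f-lin : IsLinExt (P ∖ p) (restrict p I)
      f-lin = restrict-isLinExt p I
    from : ∃ (λ f → IsLinExt (P ∖ p) f × (∀ x → φ P p f x ≡ l x)) → OnChain P l p
    from (f , f-lin , φf≗l) = chainAt⇒onChain (chainAt-resp-≗ (sym ∘ φf≗l)
      (proj₂ (Run-chainAt (extend-isLinExtExcept p f-lin) (φ-Run p f-lin))))
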